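{- Let $\mathbb{C}$ be a bicartesian closed category, $Y$ an object, and $(Z,e,\cdot)$ a monoid object with associated strong writer monad $-\times Z$. Then there is a bijective correspondence between strong monad morphisms $\alpha\colon-\times Z\Rightarrow(-\times Y)^Y$ and morphisms $f\colon Z\times Y\to Y$ satisfying (i) $f\circ(e\times Y)$ equals the canonical isomorphism $1\times Y\cong Y$, and (ii) $f\circ((\cdot)\times Y)=\mathrm{ev}_{Y,Y}\circ(f^\dagger\times f)$ (modulo the associativity isomorphism $(Z\times Z)\times Y\cong Z\times(Z\times Y)$).
   Context: $\mathrm{ev}_{X,Y}\colon X^Y\times Y\to X$ is evaluation and $(\cdot)^\dagger$ denotes transposition along $(-\times Y)\dashv(-)^Y$; so $f^\dagger\colon Z\to Y^Y$. The writer monad $-\times Z$ has unit $X\cong X\times1\xrightarrow{X\times e}X\times Z$, multiplication $(X\times Z)\times Z\cong X\times(Z\times Z)\xrightarrow{X\times\cdot}X\times Z$, and strength the associativity isomorphism $X\times(W\times Z)\cong(X\times W)\times Z$. The state monad $(-\times Y)^Y$ has unit $(\mathrm{id}_{X\times Y})^\dagger$, multiplication $(\mathrm{ev}_{X\times Y,Y})^Y$, and strength $(\cong\circ(X\times\mathrm{ev}))^\dagger\colon X\times(W\times Y)^Y\to(X\times W\times Y)^Y$. A strong monad morphism $\alpha\colon T\Rightarrow U$ is a natural transformation with $\alpha\circ\eta^T=\eta^U$, $\alpha\circ\mu^T=\mu^U\circ U(\alpha)\circ\alpha_T$ and $\alpha_{X\times W}\circ\mathrm{st}^T=\mathrm{st}^U\circ(\mathrm{id}_X\times\alpha_W)$.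 -}

module Defs where

open import Level using (Level; _⊔_) renaming (suc to lsuc)
open import Relation.Binary using (Rel; IsEquivalence; Setoid)
open import Function.Bundles using (Inverse)

record Category (o ℓ e : Level) : Set (lsuc (o ⊔ ℓ ⊔ e)) where
  infixr 9 _∘_
  infix  4 _≈_
  infix  5 _⇒_
  field
    Obj : Set o
    _⇒_ : Obj → Obj → Set ℓ
    _≈_ : ∀ {A B} → Rel (A ⇒ B) e
    id  : ∀ {A} → A ⇒ A
    _∘_ : ∀ {A B C} → B ⇒ C → A ⇒ B → A ⇒ C
    ≈-equiv   : ∀ {A B} → IsEquivalence (_≈_ {A} {B})
    ∘-resp-≈  : ∀ {A B C} {f h : B ⇒ C} {g i : A ⇒ B} → f ≈ h → g ≈ i → f ∘ g ≈ h ∘ i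
    assoc     : ∀ {A B C D} {f : A ⇒ B} {g : B ⇒ C} {h : C ⇒ D} → (h ∘ g) ∘ f ≈ h ∘ (g ∘ f)
    identityˡ : ∀ {A B} {f : A ⇒ B} → id ∘ f ≈ f
    identityʳ : ∀ {A B} {f : A ⇒ B} → f ∘ id ≈ f

record BicartesianClosed (o ℓ e : Level) : Set (lsuc (o ⊔ ℓ ⊔ e)) where
  infixr 7 _×_
  infixr 6 _+_
  infixr 8 _^_
  field
    category : Category o ℓ e
  open Category category public
  field
    ⊤   : Obj
    !   : ∀ {A} → A ⇒ ⊤
    !-unique : ∀ {A} (f : A ⇒ ⊤) → f ≈ !
    _×_   : Obj → Obj → Obj
    π₁    : ∀ {A B} → A × B ⇒ A
    π₂    : ∀ {A B} → A × B ⇒ B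
    ⟨_,_⟩ : ∀ {A B C} → C ⇒ A → C ⇒ B → C ⇒ A × B
    project₁ : ∀ {A B C} {f : C ⇒ A} {g : C ⇒ B} → π₁ ∘ ⟨ f , g ⟩ ≈ f
    project₂ : ∀ {A B C} {f : C ⇒ A} {g : C ⇒ B} → π₂ ∘ ⟨ f , g ⟩ ≈ g
    ×-unique : ∀ {A B C} {h : C ⇒ A × B} {f : C ⇒ A} {g : C ⇒ B} →
               π₁ ∘ h ≈ f → π₂ ∘ h ≈ g → ⟨ f , g ⟩ ≈ h
    _^_   : Obj → Obj → Obj
    eval  : ∀ {A B} → (B ^ A) × A ⇒ B
    curry : ∀ {A B C} → C × A ⇒ B → C ⇒ B ^ A
    curry-β : ∀ {A B C} {f : C × A ⇒ B} →
              eval ∘ ⟨ curry f ∘ π₁ , id ∘ π₂ ⟩ ≈ f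
    curry-unique : ∀ {A B C} {f : C × A ⇒ B} {g : C ⇒ B ^ A} →
              eval ∘ ⟨ g ∘ π₁ , id ∘ π₂ ⟩ ≈ f → g ≈ curry f
    ⊥   : Obj
    ¡   : ∀ {A} → ⊥ ⇒ A
    ¡-unique : ∀ {A} (f : ⊥ ⇒ A) → f ≈ ¡
    _+_   : Obj → Obj → Obj
    i₁    : ∀ {A B} → A ⇒ A + B
    i₂    : ∀ {A B} → B ⇒ A + B
    [_,_] : ∀ {A B C} → A ⇒ C → B ⇒ C → A + B ⇒ C
    inject₁ : ∀ {A B C} {f : A ⇒ C} {g : B ⇒ C} → [ f , g ] ∘ i₁ ≈ f
    inject₂ : ∀ {A B C} {f : A ⇒ C} {g : B ⇒ C} → [ f , g ] ∘ i₂ ≈ g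
    +-unique : ∀ {A B C} {h : A + B ⇒ C} {f : A ⇒ C} {g : B ⇒ C} →
               h ∘ i₁ ≈ f → h ∘ i₂ ≈ g → [ f , g ] ≈ h

  infixr 8 _⁂_
  _⁂_ : ∀ {A B C D} → A ⇒ B → C ⇒ D → A × C ⇒ B × D
  f ⁂ g = ⟨ f ∘ π₁ , g ∘ π₂ ⟩

  assocʳ : ∀ {A B C} → (A × B) × C ⇒ A × (B × C)
  assocʳ = ⟨ π₁ ∘ π₁ , ⟨ π₂ ∘ π₁ , π₂ ⟩ ⟩

  assocˡ : ∀ {A B C} → A × (B × C) ⇒ (A × B) × C
  assocˡ = ⟨ ⟨ π₁ , π₁ ∘ π₂ ⟩ , π₂ ∘ π₂ ⟩

  unitorˡ : ∀ {A} → ⊤ × A ⇒ A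
  unitorˡ = π₂

  unitorʳ⁻¹ : ∀ {A} → A ⇒ A × ⊤
  unitorʳ⁻¹ = ⟨ id , ! ⟩

  _^₁_ : ∀ {A B} → A ⇒ B → (Y : Obj) → A ^ Y ⇒ B ^ Y
  g ^₁ Y = curry (g ∘ eval)

record MonoidObject {o ℓ e} (C : BicartesianClosed o ℓ e) : Set (o ⊔ ℓ ⊔ e) where
  open BicartesianClosed C
  field
    Z    : Obj
    unit : ⊤ ⇒ Z
    mult : Z × Z ⇒ Z
    unitˡ  : mult ∘ (unit ⁂ id) ≈ unitorˡ
    unitʳ  : mult ∘ (id ⁂ unit) ≈ π₁
    massoc : mult ∘ (mult ⁂ id) ≈ mult ∘ (id ⁂ mult) ∘ assocʳ

module Monads {o ℓ e} (C : BicartesianClosed o ℓ e) (Y : BicartesianClosed.Obj C)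
              (M : MonoidObject C) where
  open BicartesianClosed C
  open MonoidObject M

  W₀ : Obj → Obj
  W₀ X = X × Z
  W₁ : ∀ {A B} → A ⇒ B → W₀ A ⇒ W₀ B
  W₁ g = g ⁂ id
  ηW : ∀ X → X ⇒ W₀ X
  ηW X = (id ⁂ unit) ∘ unitorʳ⁻¹
  μW : ∀ X → W₀ (W₀ X) ⇒ W₀ X
  μW X = (id ⁂ mult) ∘ assocʳ
  stW : ∀ X V → X × W₀ V ⇒ W₀ (X × V)
  stW X V = assocˡ

  S₀ : Obj → Obj
  S₀ X = (X × Y) ^ Y
  S₁ : ∀ {A B} → A ⇒ B → S₀ A ⇒ S₀ B
  S₁ g = (g ⁂ id) ^₁ Y
  ηS : ∀ X → X ⇒ S₀ X
  ηS X = curry (id {X × Y})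
  μS : ∀ X → S₀ (S₀ X) ⇒ S₀ X
  μS X = (eval {Y} {X × Y}) ^₁ Y
  stS : ∀ X V → X × S₀ V ⇒ S₀ (X × V)
  stS X V = curry (assocˡ ∘ (id ⁂ eval) ∘ assocʳ)

  record StrongMonadMorphism : Set (o ⊔ ℓ ⊔ e) where
    field
      α : ∀ X → W₀ X ⇒ S₀ X
      natural : ∀ {A B} (g : A ⇒ B) → α B ∘ W₁ g ≈ S₁ g ∘ α A
      preserves-η : ∀ X → α X ∘ ηW X ≈ ηS X
      preserves-μ : ∀ X → α X ∘ μW X ≈ μS X ∘ S₁ (α X) ∘ α (W₀ X)
      preserves-st : ∀ X V → α (X × V) ∘ stW X V ≈ stS X V ∘ (id ⁂ α V)
  open StrongMonadMorphism public

  StrongMonadMorphism-setoid : Setoid (o ⊔ ℓ ⊔ e) (o ⊔ e)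
  StrongMonadMorphism-setoid = record
    { Carrier = StrongMonadMorphism
    ; _≈_ = λ a b → ∀ X → α a X ≈ α b X
    ; isEquivalence = record
      { refl  = λ X → IsEquivalence.refl ≈-equiv
      ; sym   = λ p X → IsEquivalence.sym ≈-equiv (p X)
      ; trans = λ p q X → IsEquivalence.trans ≈-equiv (p X) (q X)
      }
    }

  record Action : Set (ℓ ⊔ e) where
    field
      f : Z × Y ⇒ Y
      cond-i  : f ∘ (unit ⁂ id) ≈ unitorˡ
      cond-ii : f ∘ (mult ⁂ id) ≈ eval ∘ (curry f ⁂ f) ∘ assocʳ
  open Action public

  Action-setoid : Setoid (ℓ ⊔ e) e
  Action-setoid = record
    { Carrier = Action
    ; _≈_ = λ a b → f a ≈ f b
    ; isEquivalence = record
      { refl  = IsEquivalence.refl ≈-equiv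
      ; sym   = IsEquivalence.sym ≈-equiv
      ; trans = IsEquivalence.trans ≈-equiv
      }
    }

{-# OPTIONS --safe #-}
-- A strong natural transformation α : − × Z ⇒ (− × Y)^Y is determined by its component
-- at 1: the pair (x , z) is W(π₁)(st(x , (* , z))), so naturality and strength force
-- α_X(x , z) = λ y. (x , f(z , y)) with f(z , y) = π₂(α_1(* , z)(y)).  For α of this
-- shape, preservation of the unit and of the multiplication say, on generalized elements,
-- exactly f(e , y) = y and f(a · b , y) = f(a , f(b , y)), i.e. conditions (i) and (ii);
-- conversely these two equations are read off from the laws at X = 1.
module Submission where

open import Data.Product using (_,_)
open import Function.Bundles using (Inverse)
open import Level using (_⊔_)
open import Relation.Binary using (Setoid; IsEquivalence)
import Relation.Binary.Reasoning.Setoid as SetoidReasoning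
open import Defs

module CartesianClosedReasoning {o ℓ e} (C : BicartesianClosed o ℓ e) where
  open BicartesianClosed C

  module Equiv {A B : Obj} = IsEquivalence (≈-equiv {A} {B})
  open Equiv public using (refl; sym; trans)

  hom-setoid : ∀ {A B} → Setoid ℓ e
  hom-setoid {A} {B} = record { Carrier = A ⇒ B ; _≈_ = _≈_ ; isEquivalence = ≈-equiv }

  module HomReasoning {A B : Obj} = SetoidReasoning (hom-setoid {A} {B})
  open HomReasoning public using (begin_; _∎; step-≈-⟩; step-≈-⟨)

  infixr 4 _⟩∘⟨_ refl⟩∘⟨_
  infixl 5 _⟩∘⟨refl

  _⟩∘⟨_ : ∀ {A B D} {f h : B ⇒ D} {g i : A ⇒ B} → f ≈ h → g ≈ i → f ∘ g ≈ h ∘ i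
  _⟩∘⟨_ = ∘-resp-≈

  refl⟩∘⟨_ : ∀ {A B D} {f : B ⇒ D} {g i : A ⇒ B} → g ≈ i → f ∘ g ≈ f ∘ i
  refl⟩∘⟨ p = ∘-resp-≈ refl p

  _⟩∘⟨refl : ∀ {A B D} {f h : B ⇒ D} {g : A ⇒ B} → f ≈ h → f ∘ g ≈ h ∘ g
  p ⟩∘⟨refl = ∘-resp-≈ p refl

  pullˡ : ∀ {A B D E} {f : D ⇒ E} {g : B ⇒ D} {h : B ⇒ E} {i : A ⇒ B} →
          f ∘ g ≈ h → f ∘ g ∘ i ≈ h ∘ i
  pullˡ p = trans (sym assoc) (p ⟩∘⟨refl)

  assoc² : ∀ {A B D E F} {f : A ⇒ B} {g : B ⇒ D} {h : D ⇒ E} {i : E ⇒ F} →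
           (i ∘ h ∘ g) ∘ f ≈ i ∘ h ∘ g ∘ f
  assoc² = trans assoc (refl⟩∘⟨ assoc)

  !-unique₂ : ∀ {A} {f g : A ⇒ ⊤} → f ≈ g
  !-unique₂ {f = f} {g} = trans (!-unique f) (sym (!-unique g))

  ⟨⟩-cong₂ : ∀ {A B D} {f f′ : D ⇒ A} {g g′ : D ⇒ B} → f ≈ f′ → g ≈ g′ → ⟨ f , g ⟩ ≈ ⟨ f′ , g′ ⟩
  ⟨⟩-cong₂ p q = ×-unique (trans project₁ (sym p)) (trans project₂ (sym q))

  ⟨⟩-congʳ : ∀ {A B D} {f f′ : D ⇒ A} {g : D ⇒ B} → f ≈ f′ → ⟨ f , g ⟩ ≈ ⟨ f′ , g ⟩
  ⟨⟩-congʳ p = ⟨⟩-cong₂ p refl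

  ⟨⟩-congˡ : ∀ {A B D} {f : D ⇒ A} {g g′ : D ⇒ B} → g ≈ g′ → ⟨ f , g ⟩ ≈ ⟨ f , g′ ⟩
  ⟨⟩-congˡ q = ⟨⟩-cong₂ refl q

  ⟨⟩-η : ∀ {A B D} {h : D ⇒ A × B} → ⟨ π₁ ∘ h , π₂ ∘ h ⟩ ≈ h
  ⟨⟩-η = ×-unique refl refl

  ⟨π₁,π₂⟩ : ∀ {A B} → ⟨ π₁ , π₂ ⟩ ≈ id {A × B}
  ⟨π₁,π₂⟩ = ×-unique identityʳ identityʳ

  ⟨⟩∘ : ∀ {A B D E} {f : D ⇒ A} {g : D ⇒ B} {h : E ⇒ D} → ⟨ f , g ⟩ ∘ h ≈ ⟨ f ∘ h , g ∘ h ⟩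
  ⟨⟩∘ = sym (×-unique (pullˡ project₁) (pullˡ project₂))

  ⁂-cong₂ : ∀ {A B D E} {f f′ : A ⇒ B} {g g′ : D ⇒ E} → f ≈ f′ → g ≈ g′ → f ⁂ g ≈ f′ ⁂ g′
  ⁂-cong₂ p q = ⟨⟩-cong₂ (p ⟩∘⟨refl) (q ⟩∘⟨refl)

  ⁂∘⟨⟩ : ∀ {A B D E F} {f : A ⇒ B} {g : D ⇒ E} {a : F ⇒ A} {d : F ⇒ D} →
         (f ⁂ g) ∘ ⟨ a , d ⟩ ≈ ⟨ f ∘ a , g ∘ d ⟩
  ⁂∘⟨⟩ = trans ⟨⟩∘ (⟨⟩-cong₂ (trans assoc (refl⟩∘⟨ project₁)) (trans assoc (refl⟩∘⟨ project₂)))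

  ⁂id∘⟨⟩ : ∀ {A B D F} {f : A ⇒ B} {a : F ⇒ A} {d : F ⇒ D} → (f ⁂ id) ∘ ⟨ a , d ⟩ ≈ ⟨ f ∘ a , d ⟩
  ⁂id∘⟨⟩ = trans ⁂∘⟨⟩ (⟨⟩-congˡ identityˡ)

  id⁂∘⟨⟩ : ∀ {A D E F} {g : D ⇒ E} {a : F ⇒ A} {d : F ⇒ D} → (id ⁂ g) ∘ ⟨ a , d ⟩ ≈ ⟨ a , g ∘ d ⟩
  id⁂∘⟨⟩ = trans ⁂∘⟨⟩ (⟨⟩-congʳ identityˡ)

  assocʳ∘⟨⟩ : ∀ {A B D F} {w : F ⇒ A × B} {d : F ⇒ D} →
              assocʳ ∘ ⟨ w , d ⟩ ≈ ⟨ π₁ ∘ w , ⟨ π₂ ∘ w , d ⟩ ⟩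
  assocʳ∘⟨⟩ = trans ⟨⟩∘ (⟨⟩-cong₂ (trans assoc (refl⟩∘⟨ project₁))
                                  (trans ⟨⟩∘ (⟨⟩-cong₂ (trans assoc (refl⟩∘⟨ project₁)) project₂)))

  assocʳ∘⟨⟨⟩⟩ : ∀ {A B D F} {a : F ⇒ A} {b : F ⇒ B} {d : F ⇒ D} →
                assocʳ ∘ ⟨ ⟨ a , b ⟩ , d ⟩ ≈ ⟨ a , ⟨ b , d ⟩ ⟩
  assocʳ∘⟨⟨⟩⟩ = trans assocʳ∘⟨⟩ (⟨⟩-cong₂ project₁ (⟨⟩-congʳ project₂))

  assocˡ∘⟨⟩ : ∀ {A B D F} {a : F ⇒ A} {w : F ⇒ B × D} →
              assocˡ ∘ ⟨ a , w ⟩ ≈ ⟨ ⟨ a , π₁ ∘ w ⟩ , π₂ ∘ w ⟩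
  assocˡ∘⟨⟩ = trans ⟨⟩∘ (⟨⟩-cong₂ (trans ⟨⟩∘ (⟨⟩-cong₂ project₁ (trans assoc (refl⟩∘⟨ project₂))))
                                  (trans assoc (refl⟩∘⟨ project₂)))

  assocˡ∘⟨⟨⟩⟩ : ∀ {A B D F} {a : F ⇒ A} {b : F ⇒ B} {d : F ⇒ D} →
                assocˡ ∘ ⟨ a , ⟨ b , d ⟩ ⟩ ≈ ⟨ ⟨ a , b ⟩ , d ⟩
  assocˡ∘⟨⟨⟩⟩ = trans assocˡ∘⟨⟩ (⟨⟩-cong₂ (⟨⟩-congˡ project₁) project₂)

  eval∘⟨curry⟩ : ∀ {A B D F} {f : D × A ⇒ B} {d : F ⇒ D} {a : F ⇒ A} →
                 eval ∘ ⟨ curry f ∘ d , a ⟩ ≈ f ∘ ⟨ d , a ⟩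
  eval∘⟨curry⟩ {f = f} {d} {a} = begin
    eval ∘ ⟨ curry f ∘ d , a ⟩             ≈⟨ refl⟩∘⟨ ⁂id∘⟨⟩ ⟨
    eval ∘ (curry f ⁂ id) ∘ ⟨ d , a ⟩      ≈⟨ pullˡ curry-β ⟩
    f ∘ ⟨ d , a ⟩                          ∎

  eval∘⟨^₁⟩ : ∀ {A B D F} {h : A ⇒ B} {s : F ⇒ A ^ D} {d : F ⇒ D} →
              eval ∘ ⟨ (h ^₁ D) ∘ s , d ⟩ ≈ h ∘ eval ∘ ⟨ s , d ⟩
  eval∘⟨^₁⟩ = trans eval∘⟨curry⟩ assoc

  curry-cong : ∀ {A B D} {f g : D × A ⇒ B} → f ≈ g → curry f ≈ curry g
  curry-cong p = curry-unique (trans curry-β p)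

  ^₁-cong : ∀ {A B D} {h h′ : A ⇒ B} → h ≈ h′ → h ^₁ D ≈ h′ ^₁ D
  ^₁-cong p = curry-cong (p ⟩∘⟨refl)

  eval-ext : ∀ {A B D} {g h : D ⇒ B ^ A} →
             (∀ {F} (d : F ⇒ D) (a : F ⇒ A) → eval ∘ ⟨ g ∘ d , a ⟩ ≈ eval ∘ ⟨ h ∘ d , a ⟩) →
             g ≈ h
  eval-ext p = trans (curry-unique uncurried) (sym (curry-unique (trans uncurried (sym (p π₁ π₂)))))
    where
      uncurried : ∀ {A B D} {g : D ⇒ B ^ A} → eval ∘ ⟨ g ∘ π₁ , id ∘ π₂ ⟩ ≈ eval ∘ ⟨ g ∘ π₁ , π₂ ⟩
      uncurried = refl⟩∘⟨ ⟨⟩-congˡ identityˡ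

  eval-ext⟨⟩ : ∀ {A B D E} {g h : D × E ⇒ B ^ A} →
               (∀ {F} (d : F ⇒ D) (x : F ⇒ E) (a : F ⇒ A) →
                  eval ∘ ⟨ g ∘ ⟨ d , x ⟩ , a ⟩ ≈ eval ∘ ⟨ h ∘ ⟨ d , x ⟩ , a ⟩) →
               g ≈ h
  eval-ext⟨⟩ {g = g} {h} p = eval-ext λ w a → begin
    eval ∘ ⟨ g ∘ w , a ⟩                     ≈⟨ refl⟩∘⟨ ⟨⟩-congʳ (refl⟩∘⟨ ⟨⟩-η) ⟨
    eval ∘ ⟨ g ∘ ⟨ π₁ ∘ w , π₂ ∘ w ⟩ , a ⟩   ≈⟨ p _ _ a ⟩
    eval ∘ ⟨ h ∘ ⟨ π₁ ∘ w , π₂ ∘ w ⟩ , a ⟩   ≈⟨ refl⟩∘⟨ ⟨⟩-congʳ (refl⟩∘⟨ ⟨⟩-η) ⟩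
    eval ∘ ⟨ h ∘ w , a ⟩                     ∎

module WriterToState {o ℓ e} (C : BicartesianClosed o ℓ e) (Y : BicartesianClosed.Obj C)
                     (M : MonoidObject C) where
  open BicartesianClosed C
  open MonoidObject M
  open Monads C Y M
  open CartesianClosedReasoning C

  ηW∘ : ∀ {X F} (x : F ⇒ X) → ηW X ∘ x ≈ ⟨ x , unit ∘ ! ⟩
  ηW∘ x = begin
    ((id ⁂ unit) ∘ ⟨ id , ! ⟩) ∘ x   ≈⟨ assoc ⟩
    (id ⁂ unit) ∘ ⟨ id , ! ⟩ ∘ x     ≈⟨ refl⟩∘⟨ trans ⟨⟩∘ (⟨⟩-cong₂ identityˡ !-unique₂) ⟩
    (id ⁂ unit) ∘ ⟨ x , ! ⟩          ≈⟨ id⁂∘⟨⟩ ⟩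
    ⟨ x , unit ∘ ! ⟩                 ∎

  μW∘⟨⟩ : ∀ {X F} (w : F ⇒ W₀ X) (b : F ⇒ Z) →
          μW X ∘ ⟨ w , b ⟩ ≈ ⟨ π₁ ∘ w , mult ∘ ⟨ π₂ ∘ w , b ⟩ ⟩
  μW∘⟨⟩ w b = trans assoc (trans (refl⟩∘⟨ assocʳ∘⟨⟩) id⁂∘⟨⟩)

  W₁π₁∘stW∘⟨⟨!⟩⟩ : ∀ {X F} (x : F ⇒ X) (z : F ⇒ Z) → W₁ π₁ ∘ stW X ⊤ ∘ ⟨ x , ⟨ ! , z ⟩ ⟩ ≈ ⟨ x , z ⟩
  W₁π₁∘stW∘⟨⟨!⟩⟩ x z = begin
    W₁ π₁ ∘ assocˡ ∘ ⟨ x , ⟨ ! , z ⟩ ⟩   ≈⟨ refl⟩∘⟨ assocˡ∘⟨⟨⟩⟩ ⟩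
    W₁ π₁ ∘ ⟨ ⟨ x , ! ⟩ , z ⟩            ≈⟨ ⁂id∘⟨⟩ ⟩
    ⟨ π₁ ∘ ⟨ x , ! ⟩ , z ⟩               ≈⟨ ⟨⟩-congʳ project₁ ⟩
    ⟨ x , z ⟩                           ∎

  eval∘⟨ηS⟩ : ∀ {X F} (x : F ⇒ X) (y : F ⇒ Y) → eval ∘ ⟨ ηS X ∘ x , y ⟩ ≈ ⟨ x , y ⟩
  eval∘⟨ηS⟩ x y = trans eval∘⟨curry⟩ identityˡ

  eval∘⟨S₁⟩ : ∀ {A B F} (h : A ⇒ B) (s : F ⇒ S₀ A) (y : F ⇒ Y) →
              eval ∘ ⟨ S₁ h ∘ s , y ⟩ ≈ (h ⁂ id) ∘ eval ∘ ⟨ s , y ⟩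
  eval∘⟨S₁⟩ h s y = eval∘⟨^₁⟩

  eval∘⟨μS⟩ : ∀ {X F} (s : F ⇒ S₀ (S₀ X)) (y : F ⇒ Y) →
              eval ∘ ⟨ μS X ∘ s , y ⟩ ≈ eval ∘ eval ∘ ⟨ s , y ⟩
  eval∘⟨μS⟩ s y = eval∘⟨^₁⟩

  eval∘⟨stS⟩ : ∀ {X V F} (x : F ⇒ X) (s : F ⇒ S₀ V) (y : F ⇒ Y) →
               eval ∘ ⟨ stS X V ∘ ⟨ x , s ⟩ , y ⟩ ≈ assocˡ ∘ ⟨ x , eval ∘ ⟨ s , y ⟩ ⟩
  eval∘⟨stS⟩ {X} {V} x s y = begin
    eval ∘ ⟨ stS X V ∘ ⟨ x , s ⟩ , y ⟩                ≈⟨ eval∘⟨curry⟩ ⟩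
    (assocˡ ∘ (id ⁂ eval) ∘ assocʳ) ∘ ⟨ ⟨ x , s ⟩ , y ⟩ ≈⟨ assoc² ⟩
    assocˡ ∘ (id ⁂ eval) ∘ assocʳ ∘ ⟨ ⟨ x , s ⟩ , y ⟩   ≈⟨ refl⟩∘⟨ refl⟩∘⟨ assocʳ∘⟨⟨⟩⟩ ⟩
    assocˡ ∘ (id ⁂ eval) ∘ ⟨ x , ⟨ s , y ⟩ ⟩            ≈⟨ refl⟩∘⟨ id⁂∘⟨⟩ ⟩
    assocˡ ∘ ⟨ x , eval ∘ ⟨ s , y ⟩ ⟩                   ∎

  eval∘⟨S₁π₁∘stS⟩ : ∀ {X V F} (x : F ⇒ X) (s : F ⇒ S₀ V) (y : F ⇒ Y) →
                    eval ∘ ⟨ S₁ π₁ ∘ stS X V ∘ ⟨ x , s ⟩ , y ⟩ ≈ ⟨ x , π₂ ∘ eval ∘ ⟨ s , y ⟩ ⟩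
  eval∘⟨S₁π₁∘stS⟩ {X} {V} {F} x s y = begin
    eval ∘ ⟨ S₁ π₁ ∘ stS X V ∘ ⟨ x , s ⟩ , y ⟩        ≈⟨ eval∘⟨S₁⟩ π₁ _ y ⟩
    (π₁ ⁂ id) ∘ eval ∘ ⟨ stS X V ∘ ⟨ x , s ⟩ , y ⟩    ≈⟨ refl⟩∘⟨ eval∘⟨stS⟩ x s y ⟩
    (π₁ ⁂ id) ∘ assocˡ ∘ ⟨ x , ev ⟩                   ≈⟨ refl⟩∘⟨ assocˡ∘⟨⟩ ⟩
    (π₁ ⁂ id) ∘ ⟨ ⟨ x , π₁ ∘ ev ⟩ , π₂ ∘ ev ⟩          ≈⟨ ⁂id∘⟨⟩ ⟩
    ⟨ π₁ ∘ ⟨ x , π₁ ∘ ev ⟩ , π₂ ∘ ev ⟩                ≈⟨ ⟨⟩-congʳ project₁ ⟩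
    ⟨ x , π₂ ∘ ev ⟩                                   ∎
    where
      ev : F ⇒ V × Y
      ev = eval ∘ ⟨ s , y ⟩

  αOf : Z × Y ⇒ Y → ∀ X → W₀ X ⇒ S₀ X
  αOf g X = curry ((id ⁂ g) ∘ assocʳ)

  fOf : (∀ X → W₀ X ⇒ S₀ X) → Z × Y ⇒ Y
  fOf α = π₂ ∘ eval ∘ ((α ⊤ ∘ ⟨ ! , id ⟩) ⁂ id)

  αOf-cong : ∀ {g g′ : Z × Y ⇒ Y} X → g ≈ g′ → αOf g X ≈ αOf g′ X
  αOf-cong X p = curry-cong (⁂-cong₂ refl p ⟩∘⟨refl)

  fOf-cong : ∀ {α β : ∀ X → W₀ X ⇒ S₀ X} → (∀ X → α X ≈ β X) → fOf α ≈ fOf β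
  fOf-cong p = refl⟩∘⟨ refl⟩∘⟨ ⁂-cong₂ (p ⊤ ⟩∘⟨refl) refl

  eval∘⟨αOf⟩ : ∀ g {X F} (w : F ⇒ W₀ X) (y : F ⇒ Y) →
               eval ∘ ⟨ αOf g X ∘ w , y ⟩ ≈ ⟨ π₁ ∘ w , g ∘ ⟨ π₂ ∘ w , y ⟩ ⟩
  eval∘⟨αOf⟩ g w y = trans eval∘⟨curry⟩ (trans assoc (trans (refl⟩∘⟨ assocʳ∘⟨⟩) id⁂∘⟨⟩))

  eval∘⟨αOf∘⟨⟩⟩ : ∀ g {X F} (x : F ⇒ X) (z : F ⇒ Z) (y : F ⇒ Y) →
                  eval ∘ ⟨ αOf g X ∘ ⟨ x , z ⟩ , y ⟩ ≈ ⟨ x , g ∘ ⟨ z , y ⟩ ⟩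
  eval∘⟨αOf∘⟨⟩⟩ g x z y = trans (eval∘⟨αOf⟩ g _ y) (⟨⟩-cong₂ project₁ (refl⟩∘⟨ ⟨⟩-congʳ project₂))

  fOf∘⟨⟩ : ∀ α {F} (z : F ⇒ Z) (y : F ⇒ Y) → fOf α ∘ ⟨ z , y ⟩ ≈ π₂ ∘ eval ∘ ⟨ α ⊤ ∘ ⟨ ! , z ⟩ , y ⟩
  fOf∘⟨⟩ α z y = begin
    (π₂ ∘ eval ∘ ((α ⊤ ∘ ⟨ ! , id ⟩) ⁂ id)) ∘ ⟨ z , y ⟩   ≈⟨ assoc² ⟩
    π₂ ∘ eval ∘ ((α ⊤ ∘ ⟨ ! , id ⟩) ⁂ id) ∘ ⟨ z , y ⟩     ≈⟨ refl⟩∘⟨ refl⟩∘⟨ ⁂id∘⟨⟩ ⟩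
    π₂ ∘ eval ∘ ⟨ (α ⊤ ∘ ⟨ ! , id ⟩) ∘ z , y ⟩           ≈⟨ refl⟩∘⟨ refl⟩∘⟨ ⟨⟩-congʳ (trans assoc (refl⟩∘⟨ unit-pair)) ⟩
    π₂ ∘ eval ∘ ⟨ α ⊤ ∘ ⟨ ! , z ⟩ , y ⟩                  ∎
    where
      unit-pair : ⟨ ! , id ⟩ ∘ z ≈ ⟨ ! , z ⟩
      unit-pair = trans ⟨⟩∘ (⟨⟩-cong₂ !-unique₂ identityˡ)

  fOf-αOf : ∀ g → fOf (αOf g) ≈ g
  fOf-αOf g = begin
    fOf (αOf g)                                       ≈⟨ identityʳ ⟨
    fOf (αOf g) ∘ id                                  ≈⟨ refl⟩∘⟨ ⟨π₁,π₂⟩ ⟨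
    fOf (αOf g) ∘ ⟨ π₁ , π₂ ⟩                          ≈⟨ fOf∘⟨⟩ (αOf g) π₁ π₂ ⟩
    π₂ ∘ eval ∘ ⟨ αOf g ⊤ ∘ ⟨ ! , π₁ ⟩ , π₂ ⟩          ≈⟨ refl⟩∘⟨ eval∘⟨αOf∘⟨⟩⟩ g ! π₁ π₂ ⟩
    π₂ ∘ ⟨ ! , g ∘ ⟨ π₁ , π₂ ⟩ ⟩                       ≈⟨ project₂ ⟩
    g ∘ ⟨ π₁ , π₂ ⟩                                   ≈⟨ trans (refl⟩∘⟨ ⟨π₁,π₂⟩) identityʳ ⟩
    g                                                 ∎

  αOf-natural : ∀ g {A B} (h : A ⇒ B) → αOf g B ∘ W₁ h ≈ S₁ h ∘ αOf g A
  αOf-natural g {A} {B} h = eval-ext⟨⟩ λ x z y → begin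
    eval ∘ ⟨ (αOf g B ∘ W₁ h) ∘ ⟨ x , z ⟩ , y ⟩   ≈⟨ refl⟩∘⟨ ⟨⟩-congʳ (trans assoc (refl⟩∘⟨ ⁂id∘⟨⟩)) ⟩
    eval ∘ ⟨ αOf g B ∘ ⟨ h ∘ x , z ⟩ , y ⟩         ≈⟨ eval∘⟨αOf∘⟨⟩⟩ g (h ∘ x) z y ⟩
    ⟨ h ∘ x , g ∘ ⟨ z , y ⟩ ⟩                       ≈⟨ ⁂id∘⟨⟩ ⟨
    (h ⁂ id) ∘ ⟨ x , g ∘ ⟨ z , y ⟩ ⟩                ≈⟨ refl⟩∘⟨ eval∘⟨αOf∘⟨⟩⟩ g x z y ⟨
    (h ⁂ id) ∘ eval ∘ ⟨ αOf g A ∘ ⟨ x , z ⟩ , y ⟩   ≈⟨ eval∘⟨S₁⟩ h _ y ⟨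
    eval ∘ ⟨ S₁ h ∘ αOf g A ∘ ⟨ x , z ⟩ , y ⟩       ≈⟨ refl⟩∘⟨ ⟨⟩-congʳ assoc ⟨
    eval ∘ ⟨ (S₁ h ∘ αOf g A) ∘ ⟨ x , z ⟩ , y ⟩     ∎

  αOf-strong : ∀ g X V → αOf g (X × V) ∘ stW X V ≈ stS X V ∘ (id ⁂ αOf g V)
  αOf-strong g X V = eval-ext⟨⟩ pointwise
    where
      pointwise : ∀ {F} (x : F ⇒ X) (u : F ⇒ W₀ V) (y : F ⇒ Y) →
                  eval ∘ ⟨ (αOf g (X × V) ∘ assocˡ) ∘ ⟨ x , u ⟩ , y ⟩ ≈
                  eval ∘ ⟨ (stS X V ∘ (id ⁂ αOf g V)) ∘ ⟨ x , u ⟩ , y ⟩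
      pointwise x u y = begin
        eval ∘ ⟨ (αOf g (X × V) ∘ assocˡ) ∘ ⟨ x , u ⟩ , y ⟩     ≈⟨ refl⟩∘⟨ ⟨⟩-congʳ (trans assoc (refl⟩∘⟨ assocˡ∘⟨⟩)) ⟩
        eval ∘ ⟨ αOf g (X × V) ∘ ⟨ ⟨ x , π₁ ∘ u ⟩ , π₂ ∘ u ⟩ , y ⟩ ≈⟨ eval∘⟨αOf∘⟨⟩⟩ g _ (π₂ ∘ u) y ⟩
        ⟨ ⟨ x , π₁ ∘ u ⟩ , g ∘ ⟨ π₂ ∘ u , y ⟩ ⟩                   ≈⟨ assocˡ∘⟨⟨⟩⟩ ⟨
        assocˡ ∘ ⟨ x , ⟨ π₁ ∘ u , g ∘ ⟨ π₂ ∘ u , y ⟩ ⟩ ⟩           ≈⟨ refl⟩∘⟨ ⟨⟩-congˡ (eval∘⟨αOf⟩ g u y) ⟨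
        assocˡ ∘ ⟨ x , eval ∘ ⟨ αOf g V ∘ u , y ⟩ ⟩               ≈⟨ eval∘⟨stS⟩ x _ y ⟨
        eval ∘ ⟨ stS X V ∘ ⟨ x , αOf g V ∘ u ⟩ , y ⟩              ≈⟨ refl⟩∘⟨ ⟨⟩-congʳ (trans assoc (refl⟩∘⟨ id⁂∘⟨⟩)) ⟨
        eval ∘ ⟨ (stS X V ∘ (id ⁂ αOf g V)) ∘ ⟨ x , u ⟩ , y ⟩     ∎

  eval∘⟨αOf∘ηW⟩ : ∀ g {X F} (x : F ⇒ X) (y : F ⇒ Y) →
                  eval ∘ ⟨ (αOf g X ∘ ηW X) ∘ x , y ⟩ ≈ ⟨ x , g ∘ ⟨ unit ∘ ! , y ⟩ ⟩
  eval∘⟨αOf∘ηW⟩ g x y =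
    trans (refl⟩∘⟨ ⟨⟩-congʳ (trans assoc (refl⟩∘⟨ ηW∘ x))) (eval∘⟨αOf∘⟨⟩⟩ g x _ y)

  eval∘⟨αOf∘μW⟩ : ∀ g {X F} (w : F ⇒ W₀ X) (b : F ⇒ Z) (y : F ⇒ Y) →
                  eval ∘ ⟨ (αOf g X ∘ μW X) ∘ ⟨ w , b ⟩ , y ⟩ ≈
                  ⟨ π₁ ∘ w , g ∘ ⟨ mult ∘ ⟨ π₂ ∘ w , b ⟩ , y ⟩ ⟩
  eval∘⟨αOf∘μW⟩ g w b y =
    trans (refl⟩∘⟨ ⟨⟩-congʳ (trans assoc (refl⟩∘⟨ μW∘⟨⟩ w b))) (eval∘⟨αOf∘⟨⟩⟩ g _ _ y)

  eval∘⟨μS∘S₁αOf∘αOf⟩ : ∀ g {X F} (w : F ⇒ W₀ X) (b : F ⇒ Z) (y : F ⇒ Y) →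
                        eval ∘ ⟨ (μS X ∘ S₁ (αOf g X) ∘ αOf g (W₀ X)) ∘ ⟨ w , b ⟩ , y ⟩ ≈
                        ⟨ π₁ ∘ w , g ∘ ⟨ π₂ ∘ w , g ∘ ⟨ b , y ⟩ ⟩ ⟩
  eval∘⟨μS∘S₁αOf∘αOf⟩ g {X} w b y = begin
    eval ∘ ⟨ (μS X ∘ S₁ (αOf g X) ∘ αOf g (W₀ X)) ∘ ⟨ w , b ⟩ , y ⟩
      ≈⟨ refl⟩∘⟨ ⟨⟩-congʳ assoc² ⟩
    eval ∘ ⟨ μS X ∘ S₁ (αOf g X) ∘ αOf g (W₀ X) ∘ ⟨ w , b ⟩ , y ⟩
      ≈⟨ eval∘⟨μS⟩ _ y ⟩
    eval ∘ eval ∘ ⟨ S₁ (αOf g X) ∘ αOf g (W₀ X) ∘ ⟨ w , b ⟩ , y ⟩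
      ≈⟨ refl⟩∘⟨ eval∘⟨S₁⟩ (αOf g X) _ y ⟩
    eval ∘ (αOf g X ⁂ id) ∘ eval ∘ ⟨ αOf g (W₀ X) ∘ ⟨ w , b ⟩ , y ⟩
      ≈⟨ refl⟩∘⟨ refl⟩∘⟨ eval∘⟨αOf∘⟨⟩⟩ g w b y ⟩
    eval ∘ (αOf g X ⁂ id) ∘ ⟨ w , g ∘ ⟨ b , y ⟩ ⟩
      ≈⟨ refl⟩∘⟨ ⁂id∘⟨⟩ ⟩
    eval ∘ ⟨ αOf g X ∘ w , g ∘ ⟨ b , y ⟩ ⟩
      ≈⟨ eval∘⟨αOf⟩ g w _ ⟩
    ⟨ π₁ ∘ w , g ∘ ⟨ π₂ ∘ w , g ∘ ⟨ b , y ⟩ ⟩ ⟩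
      ∎

  UnitLaw : Z × Y ⇒ Y → Set (o ⊔ ℓ ⊔ e)
  UnitLaw g = ∀ {F} (y : F ⇒ Y) → g ∘ ⟨ unit ∘ ! , y ⟩ ≈ y

  MultLaw : Z × Y ⇒ Y → Set (o ⊔ ℓ ⊔ e)
  MultLaw g = ∀ {F} (a b : F ⇒ Z) (y : F ⇒ Y) → g ∘ ⟨ mult ∘ ⟨ a , b ⟩ , y ⟩ ≈ g ∘ ⟨ a , g ∘ ⟨ b , y ⟩ ⟩

  cond-i⇒UnitLaw : ∀ {g} → g ∘ (unit ⁂ id) ≈ unitorˡ → UnitLaw g
  cond-i⇒UnitLaw {g} cond y = begin
    g ∘ ⟨ unit ∘ ! , y ⟩             ≈⟨ refl⟩∘⟨ ⁂id∘⟨⟩ ⟨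
    g ∘ (unit ⁂ id) ∘ ⟨ ! , y ⟩      ≈⟨ pullˡ cond ⟩
    π₂ ∘ ⟨ ! , y ⟩                   ≈⟨ project₂ ⟩
    y                               ∎

  UnitLaw⇒cond-i : ∀ {g} → UnitLaw g → g ∘ (unit ⁂ id) ≈ unitorˡ
  UnitLaw⇒cond-i {g} law = begin
    g ∘ ⟨ unit ∘ π₁ , id ∘ π₂ ⟩      ≈⟨ refl⟩∘⟨ ⟨⟩-cong₂ (refl⟩∘⟨ !-unique₂) identityˡ ⟩
    g ∘ ⟨ unit ∘ ! , π₂ ⟩            ≈⟨ law π₂ ⟩
    π₂                              ∎

  cond-ii⇒MultLaw : ∀ {g} → g ∘ (mult ⁂ id) ≈ eval ∘ (curry g ⁂ g) ∘ assocʳ → MultLaw g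
  cond-ii⇒MultLaw {g} cond a b y = begin
    g ∘ ⟨ mult ∘ ⟨ a , b ⟩ , y ⟩                          ≈⟨ refl⟩∘⟨ ⁂id∘⟨⟩ ⟨
    g ∘ (mult ⁂ id) ∘ ⟨ ⟨ a , b ⟩ , y ⟩                   ≈⟨ pullˡ cond ⟩
    (eval ∘ (curry g ⁂ g) ∘ assocʳ) ∘ ⟨ ⟨ a , b ⟩ , y ⟩   ≈⟨ assoc² ⟩
    eval ∘ (curry g ⁂ g) ∘ assocʳ ∘ ⟨ ⟨ a , b ⟩ , y ⟩     ≈⟨ refl⟩∘⟨ refl⟩∘⟨ assocʳ∘⟨⟨⟩⟩ ⟩
    eval ∘ (curry g ⁂ g) ∘ ⟨ a , ⟨ b , y ⟩ ⟩              ≈⟨ refl⟩∘⟨ ⁂∘⟨⟩ ⟩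
    eval ∘ ⟨ curry g ∘ a , g ∘ ⟨ b , y ⟩ ⟩                ≈⟨ eval∘⟨curry⟩ ⟩
    g ∘ ⟨ a , g ∘ ⟨ b , y ⟩ ⟩                             ∎

  MultLaw⇒cond-ii : ∀ {g} → MultLaw g → g ∘ (mult ⁂ id) ≈ eval ∘ (curry g ⁂ g) ∘ assocʳ
  MultLaw⇒cond-ii {g} law = begin
    g ∘ ⟨ mult ∘ π₁ , id ∘ π₂ ⟩                              ≈⟨ refl⟩∘⟨ ⟨⟩-cong₂ (refl⟩∘⟨ sym ⟨⟩-η) identityˡ ⟩
    g ∘ ⟨ mult ∘ ⟨ π₁ ∘ π₁ , π₂ ∘ π₁ ⟩ , π₂ ⟩                ≈⟨ law (π₁ ∘ π₁) (π₂ ∘ π₁) π₂ ⟩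
    g ∘ ⟨ π₁ ∘ π₁ , g ∘ ⟨ π₂ ∘ π₁ , π₂ ⟩ ⟩                   ≈⟨ eval∘⟨curry⟩ ⟨
    eval ∘ ⟨ curry g ∘ π₁ ∘ π₁ , g ∘ ⟨ π₂ ∘ π₁ , π₂ ⟩ ⟩      ≈⟨ refl⟩∘⟨ ⁂∘⟨⟩ ⟨
    eval ∘ (curry g ⁂ g) ∘ assocʳ                           ∎

  αOf-η : ∀ {g} → UnitLaw g → ∀ X → αOf g X ∘ ηW X ≈ ηS X
  αOf-η {g} law X = eval-ext λ x y → begin
    eval ∘ ⟨ (αOf g X ∘ ηW X) ∘ x , y ⟩   ≈⟨ eval∘⟨αOf∘ηW⟩ g x y ⟩
    ⟨ x , g ∘ ⟨ unit ∘ ! , y ⟩ ⟩          ≈⟨ ⟨⟩-congˡ (law y) ⟩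
    ⟨ x , y ⟩                             ≈⟨ eval∘⟨ηS⟩ x y ⟨
    eval ∘ ⟨ ηS X ∘ x , y ⟩               ∎

  αOf-η⇒UnitLaw : ∀ {g} → αOf g ⊤ ∘ ηW ⊤ ≈ ηS ⊤ → UnitLaw g
  αOf-η⇒UnitLaw {g} η-law y = begin
    g ∘ ⟨ unit ∘ ! , y ⟩                      ≈⟨ project₂ ⟨
    π₂ ∘ ⟨ ! , g ∘ ⟨ unit ∘ ! , y ⟩ ⟩          ≈⟨ refl⟩∘⟨ eval∘⟨αOf∘ηW⟩ g ! y ⟨
    π₂ ∘ eval ∘ ⟨ (αOf g ⊤ ∘ ηW ⊤) ∘ ! , y ⟩   ≈⟨ refl⟩∘⟨ refl⟩∘⟨ ⟨⟩-congʳ (η-law ⟩∘⟨refl) ⟩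
    π₂ ∘ eval ∘ ⟨ ηS ⊤ ∘ ! , y ⟩               ≈⟨ refl⟩∘⟨ eval∘⟨ηS⟩ ! y ⟩
    π₂ ∘ ⟨ ! , y ⟩                             ≈⟨ project₂ ⟩
    y                                         ∎

  αOf-μ : ∀ {g} → MultLaw g → ∀ X → αOf g X ∘ μW X ≈ μS X ∘ S₁ (αOf g X) ∘ αOf g (W₀ X)
  αOf-μ {g} law X = eval-ext⟨⟩ λ w b y → begin
    eval ∘ ⟨ (αOf g X ∘ μW X) ∘ ⟨ w , b ⟩ , y ⟩          ≈⟨ eval∘⟨αOf∘μW⟩ g w b y ⟩
    ⟨ π₁ ∘ w , g ∘ ⟨ mult ∘ ⟨ π₂ ∘ w , b ⟩ , y ⟩ ⟩       ≈⟨ ⟨⟩-congˡ (law (π₂ ∘ w) b y) ⟩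
    ⟨ π₁ ∘ w , g ∘ ⟨ π₂ ∘ w , g ∘ ⟨ b , y ⟩ ⟩ ⟩         ≈⟨ eval∘⟨μS∘S₁αOf∘αOf⟩ g w b y ⟨
    eval ∘ ⟨ (μS X ∘ S₁ (αOf g X) ∘ αOf g (W₀ X)) ∘ ⟨ w , b ⟩ , y ⟩ ∎

  αOf-μ⇒MultLaw : ∀ {g} → αOf g ⊤ ∘ μW ⊤ ≈ μS ⊤ ∘ S₁ (αOf g ⊤) ∘ αOf g (W₀ ⊤) → MultLaw g
  αOf-μ⇒MultLaw {g} μ-law {F} a b y = begin
    g ∘ ⟨ mult ∘ ⟨ a , b ⟩ , y ⟩                                      ≈⟨ refl⟩∘⟨ ⟨⟩-congʳ (refl⟩∘⟨ ⟨⟩-congʳ project₂) ⟨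
    g ∘ ⟨ mult ∘ ⟨ π₂ ∘ w , b ⟩ , y ⟩                                 ≈⟨ project₂ ⟨
    π₂ ∘ ⟨ π₁ ∘ w , g ∘ ⟨ mult ∘ ⟨ π₂ ∘ w , b ⟩ , y ⟩ ⟩                ≈⟨ refl⟩∘⟨ eval∘⟨αOf∘μW⟩ g w b y ⟨
    π₂ ∘ eval ∘ ⟨ (αOf g ⊤ ∘ μW ⊤) ∘ ⟨ w , b ⟩ , y ⟩                   ≈⟨ refl⟩∘⟨ refl⟩∘⟨ ⟨⟩-congʳ (μ-law ⟩∘⟨refl) ⟩
    π₂ ∘ eval ∘ ⟨ (μS ⊤ ∘ S₁ (αOf g ⊤) ∘ αOf g (W₀ ⊤)) ∘ ⟨ w , b ⟩ , y ⟩
                                                     ≈⟨ refl⟩∘⟨ eval∘⟨μS∘S₁αOf∘αOf⟩ g w b y ⟩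
    π₂ ∘ ⟨ π₁ ∘ w , g ∘ ⟨ π₂ ∘ w , g ∘ ⟨ b , y ⟩ ⟩ ⟩                   ≈⟨ project₂ ⟩
    g ∘ ⟨ π₂ ∘ w , g ∘ ⟨ b , y ⟩ ⟩                                    ≈⟨ refl⟩∘⟨ ⟨⟩-congʳ project₂ ⟩
    g ∘ ⟨ a , g ∘ ⟨ b , y ⟩ ⟩                                         ∎
    where
      w : F ⇒ W₀ ⊤
      w = ⟨ ! , a ⟩

  αOf-fOf : (α : ∀ X → W₀ X ⇒ S₀ X) →
            (∀ {A B} (h : A ⇒ B) → α B ∘ W₁ h ≈ S₁ h ∘ α A) →
            (∀ X V → α (X × V) ∘ stW X V ≈ stS X V ∘ (id ⁂ α V)) →
            ∀ X → α X ≈ αOf (fOf α) X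
  αOf-fOf α natural strong X = eval-ext⟨⟩ λ x z y → begin
    eval ∘ ⟨ α X ∘ ⟨ x , z ⟩ , y ⟩                          ≈⟨ refl⟩∘⟨ ⟨⟩-congʳ (α-via-⊤ x z) ⟩
    eval ∘ ⟨ S₁ π₁ ∘ stS X ⊤ ∘ ⟨ x , α ⊤ ∘ ⟨ ! , z ⟩ ⟩ , y ⟩ ≈⟨ eval∘⟨S₁π₁∘stS⟩ x _ y ⟩
    ⟨ x , π₂ ∘ eval ∘ ⟨ α ⊤ ∘ ⟨ ! , z ⟩ , y ⟩ ⟩              ≈⟨ ⟨⟩-congˡ (fOf∘⟨⟩ α z y) ⟨
    ⟨ x , fOf α ∘ ⟨ z , y ⟩ ⟩                                ≈⟨ eval∘⟨αOf∘⟨⟩⟩ (fOf α) x z y ⟨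
    eval ∘ ⟨ αOf (fOf α) X ∘ ⟨ x , z ⟩ , y ⟩                 ∎
    where
      α-via-⊤ : ∀ {F} (x : F ⇒ X) (z : F ⇒ Z) →
                α X ∘ ⟨ x , z ⟩ ≈ S₁ π₁ ∘ stS X ⊤ ∘ ⟨ x , α ⊤ ∘ ⟨ ! , z ⟩ ⟩
      α-via-⊤ x z = begin
        α X ∘ ⟨ x , z ⟩                                        ≈⟨ refl⟩∘⟨ W₁π₁∘stW∘⟨⟨!⟩⟩ x z ⟨
        α X ∘ W₁ π₁ ∘ stW X ⊤ ∘ ⟨ x , ⟨ ! , z ⟩ ⟩              ≈⟨ pullˡ (natural π₁) ⟩
        (S₁ π₁ ∘ α (X × ⊤)) ∘ stW X ⊤ ∘ ⟨ x , ⟨ ! , z ⟩ ⟩      ≈⟨ assoc ⟩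
        S₁ π₁ ∘ α (X × ⊤) ∘ stW X ⊤ ∘ ⟨ x , ⟨ ! , z ⟩ ⟩        ≈⟨ refl⟩∘⟨ pullˡ (strong X ⊤) ⟩
        S₁ π₁ ∘ (stS X ⊤ ∘ (id ⁂ α ⊤)) ∘ ⟨ x , ⟨ ! , z ⟩ ⟩     ≈⟨ refl⟩∘⟨ assoc ⟩
        S₁ π₁ ∘ stS X ⊤ ∘ (id ⁂ α ⊤) ∘ ⟨ x , ⟨ ! , z ⟩ ⟩       ≈⟨ refl⟩∘⟨ refl⟩∘⟨ id⁂∘⟨⟩ ⟩
        S₁ π₁ ∘ stS X ⊤ ∘ ⟨ x , α ⊤ ∘ ⟨ ! , z ⟩ ⟩              ∎

  toMorphism : Action → StrongMonadMorphism
  toMorphism act = record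
    { α            = αOf (f act)
    ; natural      = αOf-natural (f act)
    ; preserves-η  = αOf-η (cond-i⇒UnitLaw (cond-i act))
    ; preserves-μ  = αOf-μ (cond-ii⇒MultLaw (cond-ii act))
    ; preserves-st = αOf-strong (f act)
    }

  α≈αOf-fOf : ∀ (a : StrongMonadMorphism) X → α a X ≈ αOf (fOf (α a)) X
  α≈αOf-fOf a = αOf-fOf (α a) (natural a) (preserves-st a)

  toAction : StrongMonadMorphism → Action
  toAction a = record
    { f       = g
    ; cond-i  = UnitLaw⇒cond-i (αOf-η⇒UnitLaw η-law)
    ; cond-ii = MultLaw⇒cond-ii (αOf-μ⇒MultLaw μ-law)
    }
    where
      g : Z × Y ⇒ Y
      g = fOf (α a)

      α≈ : ∀ X → α a X ≈ αOf g X
      α≈ = α≈αOf-fOf a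

      η-law : αOf g ⊤ ∘ ηW ⊤ ≈ ηS ⊤
      η-law = trans (sym (α≈ ⊤) ⟩∘⟨refl) (preserves-η a ⊤)

      μ-law : αOf g ⊤ ∘ μW ⊤ ≈ μS ⊤ ∘ S₁ (αOf g ⊤) ∘ αOf g (W₀ ⊤)
      μ-law = trans (sym (α≈ ⊤) ⟩∘⟨refl)
                    (trans (preserves-μ a ⊤) (refl⟩∘⟨ ^₁-cong (⁂-cong₂ (α≈ ⊤) refl) ⟩∘⟨ α≈ (W₀ ⊤)))

propositionC1 : ∀ {o ℓ e} (C : BicartesianClosed o ℓ e) (Y : BicartesianClosed.Obj C)
                  (M : MonoidObject C) →
                  Inverse (Monads.StrongMonadMorphism-setoid C Y M) (Monads.Action-setoid C Y M)
propositionC1 C Y M = record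
  { to        = toAction
  ; from      = toMorphism
  ; to-cong   = fOf-cong
  ; from-cong = λ p X → αOf-cong X p
  ; inverse   = (λ {act} p → trans (fOf-cong p) (fOf-αOf (f act)))
              , (λ {a} p X → trans (αOf-cong X p) (sym (α≈αOf-fOf a X)))
  }
  where
    open Monads C Y M using (f; α)
    open CartesianClosedReasoning C using (trans; sym)
    open WriterToState C Y M
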